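{- Let $r\ge 2$, $s\ge 2$, $t\ge 2$ be integers. Let $H$ be an $(m,n)$-hm-bipartite linear $r$-uniform hypergraph with hm-bipartition $V(H)=V_1\cup V_2$, $|V_1|=m$, $|V_2|=n$, which is exact $\mathcal{B}_r(K_{s,t})$-free. Suppose further that $H$ is $\mathcal{B}_r(C_3)$-free. Then \[ e(H)\le\frac{(t-1)^{\frac{1}{s}}}{r-1}mn^{1-\frac{1}{s}}+\frac{s-1}{r-1}n.\]
   Context: An $r$-uniform hypergraph has every edge an $r$-element subset of the vertex set; it is linear if any two distinct edges share at most one vertex; $e(H)$ is its number of edges. It is hm-bipartite with hm-bipartition $V(H)=V_1\cup V_2$ (head part $V_1$, mass part $V_2$) if every edge meets $V_1$ in exactly one vertex and $V_2$ in exactly $r-1$ vertices; it is $(m,n)$-hm-bipartite if $|V_1|=m$, $|V_2|=n$. For a simple graph $F$, an $r$-uniform hypergraph is a Berge-$F$ if $V(F)$ is contained in its vertex set and there is a bijection $\phi$ from $E(F)$ to its edge set with $e\subseteq\phi(e)$ for all $e\in E(F)$; $\mathcal{B}_r(F)$ is the family of all $r$-uniform Berge-$F$ hypergraphs, and $H$ is $\mathcal{B}_r(F)$-free if it contains no subhypergraph isomorphic to a member of $\mathcal{B}_r(F)$. $C_3$ is the triangle and $K_{s,t}$ the complete bipartite graph with parts of sizes $s$ and $t$. An hm-bipartite $H$ is exact $\mathcal{B}_r(K_{s,t})$-free if it contains no subhypergraph isomorphic to a member of $\mathcal{B}_r(K_{s,t})$ in which the $s$-vertex part of $K_{s,t}$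 lies in the head part $V_1$ and the $t$-vertex part lies in the mass part $V_2$. -}

module Defs where

open import Data.Nat using (ℕ; suc; _+_; _≤_; _<_)
open import Data.Fin using (Fin; toℕ; zero; suc)
open import Data.Fin.Subset using (Subset; _∈_; _∩_; ∣_∣)
open import Data.List using (List; length; lookup)
open import Data.List.Relation.Unary.Unique.Propositional using (Unique)
open import Data.Product using (_×_; _,_; ∃; Σ-syntax)
open import Function.Definitions using (Injective)
open import Relation.Binary.PropositionalEquality using (_≡_; _≢_)
open import Relation.Nullary using (¬_)

-- Vertex set V(H) = Fin (m + n); the head part V₁ consists of the first m
-- vertices (toℕ v < m), the mass part V₂ of the last n vertices.

record Hypergraph (m n : ℕ) : Set where
  constructor mkHypergraph
  field
    edges : List (Subset (m + n))

open Hypergraph public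

e : ∀ {m n} → Hypergraph m n → ℕ
e H = length (edges H)

Edge : ∀ {m n} → Hypergraph m n → Set
Edge H = Fin (length (edges H))

edge : ∀ {m n} (H : Hypergraph m n) → Edge H → Subset (m + n)
edge H i = lookup (edges H) i

InHead : ∀ {m n} → Fin (m + n) → Set
InHead {m} v = toℕ v < m

InMass : ∀ {m n} → Fin (m + n) → Set
InMass {m} v = m ≤ toℕ v

headPart : ∀ {m n} → Subset (m + n)
headPart {m} {n} = Data.Vec.tabulate (λ v → toℕ v Data.Nat.<ᵇ m)
  where import Data.Vec ; import Data.Nat

IsUniform : ∀ {m n} → ℕ → Hypergraph m n → Set
IsUniform {m} {n} r H = Unique (edges H) × (∀ i → ∣ edge H i ∣ ≡ r)

IsHmBipartite : ∀ {m n} → Hypergraph m n → Set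
IsHmBipartite {m} {n} H = ∀ i → ∣ edge H i ∩ headPart {m} {n} ∣ ≡ 1

IsLinear : ∀ {m n} → Hypergraph m n → Set
IsLinear {m} {n} H = ∀ (i j : Edge H) → i ≢ j → ∣ edge H i ∩ edge H j ∣ ≤ 1

C3-end₁ : Fin 3 → Fin 3
C3-end₁ k = k

C3-end₂ : Fin 3 → Fin 3
C3-end₂ zero = suc zero
C3-end₂ (suc zero) = suc (suc zero)
C3-end₂ (suc (suc zero)) = zero

ContainsBergeC3 : ∀ {m n} → Hypergraph m n → Set
ContainsBergeC3 {m} {n} H =
  Σ[ f ∈ (Fin 3 → Fin (m + n)) ] Σ[ g ∈ (Fin 3 → Edge H) ]
    Injective _≡_ _≡_ f × Injective _≡_ _≡_ g ×
    (∀ k → f (C3-end₁ k) ∈ edge H (g k) × f (C3-end₂ k) ∈ edge H (g k))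

BergeC3Free : ∀ {m n} → Hypergraph m n → Set
BergeC3Free H = ¬ ContainsBergeC3 H

-- H contains a Berge-K_{s,t} with the s-part in V₁ and the t-part in V₂
-- (the two parts are then automatically disjoint).
ContainsExactBergeK : ∀ {m n} → ℕ → ℕ → Hypergraph m n → Set
ContainsExactBergeK {m} {n} s t H =
  Σ[ a ∈ (Fin s → Fin (m + n)) ] Σ[ b ∈ (Fin t → Fin (m + n)) ]
  Σ[ g ∈ (Fin s × Fin t → Edge H) ]
    Injective _≡_ _≡_ a × Injective _≡_ _≡_ b × Injective _≡_ _≡_ g ×
    (∀ i → InHead {m} {n} (a i)) × (∀ j → InMass {m} {n} (b j)) ×
    (∀ i j → a i ∈ edge H (g (i , j)) × b j ∈ edge H (g (i , j)))

ExactBergeKFree : ∀ {m n} → ℕ → ℕ → Hypergraph m n → Set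
ExactBergeKFree s t H = ¬ ContainsExactBergeK s t H

{-# OPTIONS --safe #-}
-- Join a head v to a mass w in the shadow of H when some edge contains both.
-- Every edge has r − 1 masses and, by linearity, a head–mass pair lies in at
-- most one edge, so (r − 1)·e(H) ≤ Σ_w deg w.  The edges realising a K_{s,t} of
-- the shadow are pairwise distinct: if one edge realised both (a, w) and (a, w'),
-- then for a second head a' it would form a Berge triangle with the edges
-- realising (a', w) and (a', w').  So the shadow is K_{s,t}-free, and
-- Kővári–Sós–Turán double counting gives Σ_w (deg w)(deg w − 1)⋯(deg w − s + 1)
-- ≤ (t − 1)·m^s.  Since (d − s + 1)^s ≤ d(d − 1)⋯(d − s + 1), the power-mean
-- inequality (obtained from Chebyshev's sum inequality) bounds the s-th power of
-- Σ_w (deg w − (s − 1)) ≥ (r − 1)·e(H) − (s − 1)·n by n^{s−1}·(t − 1)·m^s.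

module Submission where

open import Defs
open import Data.Nat using (ℕ; _≤_; _*_; _∸_; _^_)
open import Data.Nat using (zero; suc; _+_; _<_; z≤n; s≤s; s≤s⁻¹; _<ᵇ_)
open import Data.Nat.Properties hiding (suc-injective; _≟_)
open import Data.Nat.Tactic.RingSolver using (solve-∀)
open import Data.Bool using (Bool; true; false; _∧_; _∨_; not)
open import Data.Bool.Properties using (∧-identityʳ; ∧-zeroʳ)
open import Data.Fin using (Fin; zero; suc; toℕ; punchIn; _↑ˡ_; _↑ʳ_; splitAt; _≟_)
open import Data.Fin.Properties
  using (suc-injective; punchInᵢ≢i; toℕ<n; toℕ-↑ˡ; toℕ-↑ʳ; ↑ˡ-injective; ↑ʳ-injective;
         splitAt-↑ˡ; splitAt-↑ʳ)
open import Data.Fin.Subset using (Subset; _∈_; _∩_; ∣_∣)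
open import Data.Vec as Vec using (lookup)
open import Data.Vec.Properties using (lookup⇒[]=; lookup-zipWith; lookup∘tabulate)
open import Data.Vec.Functional using (Vector; []; _∷_)
open import Data.Product using (Σ-syntax; ∃-syntax; _×_; _,_; proj₁; proj₂)
open import Data.Sum using (inj₁; inj₂)
open import Data.Empty using (⊥-elim)
open import Function using (_∘_)
open import Function.Definitions using (Injective)
open import Relation.Binary.PropositionalEquality
open import Relation.Nullary using (¬_; does; contradiction)
open import Relation.Nullary.Decidable using (dec-true; dec-false; decidable-stable)
open import Algebra.Properties.Semiring.Sum +-*-semiring
  using (sum; sum-syntax; sum-cong-≗; sum-remove; ∑-distrib-+; ∑-comm; *-distribˡ-sum; *-distribʳ-sum)

∑-mono-≤ : ∀ {k} {f g : Fin k → ℕ} → (∀ i → f i ≤ g i) → sum f ≤ sum g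
∑-mono-≤ {zero}  f≤g = z≤n
∑-mono-≤ {suc k} f≤g = +-mono-≤ (f≤g zero) (∑-mono-≤ (f≤g ∘ suc))

∑-const : ∀ k c → ∑[ i < k ] c ≡ k * c
∑-const zero    c = refl
∑-const (suc k) c = cong (c +_) (∑-const k c)

∑-∸-const : ∀ {k} (f : Fin k → ℕ) c → sum f ∸ c * k ≤ ∑[ i < k ] (f i ∸ c)
∑-∸-const {k} f c = m≤n+o⇒m∸n≤o (sum f) (c * k) (begin
  sum f                                    ≤⟨ ∑-mono-≤ (λ i → m≤n+m∸n (f i) c) ⟩
  ∑[ i < k ] (c + (f i ∸ c))               ≡⟨ ∑-distrib-+ (λ _ → c) (λ i → f i ∸ c) ⟩
  ∑[ i < k ] c + ∑[ i < k ] (f i ∸ c)      ≡⟨ cong (_+ ∑[ i < k ] (f i ∸ c)) (∑-const k c) ⟩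
  k * c + ∑[ i < k ] (f i ∸ c)             ≡⟨ cong (_+ ∑[ i < k ] (f i ∸ c)) (*-comm k c) ⟩
  c * k + ∑[ i < k ] (f i ∸ c)             ∎)
  where open ≤-Reasoning

∑-split : ∀ m n (f : Fin (m + n) → ℕ) → sum f ≡ ∑[ v < m ] f (v ↑ˡ n) + ∑[ w < n ] f (m ↑ʳ w)
∑-split zero    n f = refl
∑-split (suc m) n f = trans (cong (f zero +_) (∑-split m n (f ∘ suc))) (sym (+-assoc (f zero) _ _))

sum-*-sum : ∀ {k l} (f : Fin k → ℕ) (g : Fin l → ℕ) → sum f * sum g ≡ ∑[ i < k ] ∑[ j < l ] (f i * g j)
sum-*-sum f g = trans (*-distribʳ-sum (sum g) f) (sum-cong-≗ (λ i → *-distribˡ-sum (f i) g))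

∑∑-distrib-+ : ∀ {k l} (f g : Fin k → Fin l → ℕ) →
  ∑[ i < k ] ∑[ j < l ] (f i j + g i j) ≡ ∑[ i < k ] ∑[ j < l ] f i j + ∑[ i < k ] ∑[ j < l ] g i j
∑∑-distrib-+ {l = l} f g =
  trans (sum-cong-≗ (λ i → ∑-distrib-+ (f i) (g i)))
        (∑-distrib-+ (λ i → ∑[ j < l ] f i j) (λ i → ∑[ j < l ] g i j))

rearrangement : ∀ {a b c d} → a ≤ c → b ≤ d → a * d + c * b ≤ a * b + c * d
rearrangement {a} {b} a≤c b≤d with m≤n⇒∃[o]m+o≡n a≤c | m≤n⇒∃[o]m+o≡n b≤d
... | p , refl | q , refl = subst₂ _≤_ (lhs a b p q) (rhs a b p q) (m≤m+n _ (p * q))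
  where
  lhs : ∀ a b p q → a * b + a * b + a * q + p * b ≡ a * (b + q) + (a + p) * b
  lhs = solve-∀
  rhs : ∀ a b p q → a * b + a * b + a * q + p * b + p * q ≡ a * b + (a + p) * (b + q)
  rhs = solve-∀

chebyshev : ∀ {n} (a b : Fin n → ℕ) → (∀ i j → a i ≤ a j → b i ≤ b j) →
            sum a * sum b ≤ n * ∑[ i < n ] (a i * b i)
chebyshev {n} a b similar = *-cancelˡ-≤ 2 (begin
  2 * (sum a * sum b)
    ≡⟨ double (sum a * sum b) ⟩
  sum a * sum b + sum a * sum b
    ≡⟨ cong₂ _+_ (sum-*-sum a b) (trans (sum-*-sum a b) (∑-comm (λ i j → a i * b j))) ⟩
  ∑[ i < n ] ∑[ j < n ] (a i * b j) + ∑[ i < n ] ∑[ j < n ] (a j * b i)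
    ≡⟨ ∑∑-distrib-+ (λ i j → a i * b j) (λ i j → a j * b i) ⟨
  ∑[ i < n ] ∑[ j < n ] (a i * b j + a j * b i)
    ≤⟨ ∑-mono-≤ (λ i → ∑-mono-≤ (pairwise i)) ⟩
  ∑[ i < n ] ∑[ j < n ] (a i * b i + a j * b j)
    ≡⟨ ∑∑-distrib-+ (λ i j → a i * b i) (λ i j → a j * b j) ⟩
  ∑[ i < n ] ∑[ j < n ] (a i * b i) + ∑[ i < n ] ∑[ j < n ] (a j * b j)
    ≡⟨ cong₂ _+_ diagonal (∑-const n S) ⟩
  n * S + n * S
    ≡⟨ double (n * S) ⟨
  2 * (n * S) ∎)
  where
  open ≤-Reasoning
  S = ∑[ i < n ] (a i * b i)
  double : ∀ x → 2 * x ≡ x + x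
  double = solve-∀
  diagonal : ∑[ i < n ] ∑[ j < n ] (a i * b i) ≡ n * S
  diagonal = trans (sum-cong-≗ (λ i → ∑-const n (a i * b i))) (sym (*-distribˡ-sum n (λ i → a i * b i)))
  pairwise : ∀ i j → a i * b j + a j * b i ≤ a i * b i + a j * b j
  pairwise i j with ≤-total (a i) (a j)
  ... | inj₁ aᵢ≤aⱼ = rearrangement aᵢ≤aⱼ (similar i j aᵢ≤aⱼ)
  ... | inj₂ aⱼ≤aᵢ = subst₂ _≤_ (+-comm (a j * b i) _) (+-comm (a j * b j) _)
                             (rearrangement aⱼ≤aᵢ (similar j i aⱼ≤aᵢ))

power-mean : ∀ {n} k (x : Fin n → ℕ) → sum x ^ suc k ≤ n ^ k * ∑[ i < n ] (x i ^ suc k)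
power-mean {n} zero x = ≤-reflexive (begin
  sum x ^ 1                  ≡⟨ ^-identityʳ (sum x) ⟩
  sum x                      ≡⟨ sum-cong-≗ (λ i → ^-identityʳ (x i)) ⟨
  ∑[ i < n ] (x i ^ 1)         ≡⟨ *-identityˡ _ ⟨
  1 * ∑[ i < n ] (x i ^ 1)     ∎)
  where open ≡-Reasoning
power-mean {n} (suc k) x = begin
  sum x * sum x ^ suc k
    ≤⟨ *-monoʳ-≤ (sum x) (power-mean k x) ⟩
  sum x * (n ^ k * ∑[ i < n ] (x i ^ suc k))
    ≡⟨ x*[y*z]≡y*[x*z] (sum x) (n ^ k) _ ⟩
  n ^ k * (sum x * ∑[ i < n ] (x i ^ suc k))
    ≤⟨ *-monoʳ-≤ (n ^ k) (chebyshev x (λ i → x i ^ suc k) (λ _ _ → ^-monoˡ-≤ (suc k))) ⟩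
  n ^ k * (n * ∑[ i < n ] (x i ^ suc (suc k)))
    ≡⟨ x*[y*z]≡y*[x*z] (n ^ k) n _ ⟩
  n * (n ^ k * ∑[ i < n ] (x i ^ suc (suc k)))
    ≡⟨ *-assoc n (n ^ k) _ ⟨
  n ^ suc k * ∑[ i < n ] (x i ^ suc (suc k)) ∎
  where
  open ≤-Reasoning
  x*[y*z]≡y*[x*z] : ∀ x y z → x * (y * z) ≡ y * (x * z)
  x*[y*z]≡y*[x*z] = solve-∀

infixr 8 _↓_

_↓_ : ℕ → ℕ → ℕ
d ↓ zero  = 1
d ↓ suc k = d * (d ∸ 1) ↓ k

[d∸k]^[1+k]≤d↓[1+k] : ∀ d k → (d ∸ k) ^ suc k ≤ d ↓ suc k
[d∸k]^[1+k]≤d↓[1+k] d zero    = ≤-refl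
[d∸k]^[1+k]≤d↓[1+k] d (suc k) = begin
  (d ∸ suc k) * (d ∸ suc k) ^ suc k      ≤⟨ *-monoˡ-≤ _ (m∸n≤m d (suc k)) ⟩
  d * (d ∸ suc k) ^ suc k                ≡⟨ cong (λ x → d * x ^ suc k) (∸-+-assoc d 1 k) ⟨
  d * (d ∸ 1 ∸ k) ^ suc k                ≤⟨ *-monoʳ-≤ d ([d∸k]^[1+k]≤d↓[1+k] (d ∸ 1) k) ⟩
  d * (d ∸ 1) ↓ suc k                    ∎
  where open ≤-Reasoning

⟦_⟧ : Bool → ℕ
⟦ true  ⟧ = 1
⟦ false ⟧ = 0

⟦∧⟧ : ∀ x y → ⟦ x ∧ y ⟧ ≡ ⟦ x ⟧ * ⟦ y ⟧
⟦∧⟧ true  y = sym (+-identityʳ ⟦ y ⟧)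
⟦∧⟧ false y = refl

∧-≡true : ∀ {x y} → x ∧ y ≡ true → x ≡ true × y ≡ true
∧-≡true {true} {true} _ = refl , refl

count : ∀ {k} → (Fin k → Bool) → ℕ
count {k} p = ∑[ i < k ] ⟦ p i ⟧

any : ∀ {k} → (Fin k → Bool) → Bool
any {zero}  p = false
any {suc k} p = p zero ∨ any (p ∘ suc)

any-witness : ∀ {k} (p : Fin k → Bool) → any p ≡ true → ∃[ i ] p i ≡ true
any-witness {suc k} p any≡true with p zero in p₀≡true
... | true  = zero , p₀≡true
... | false = let i , pᵢ≡true = any-witness (p ∘ suc) any≡true in suc i , pᵢ≡true

any-false : ∀ {k} (p : Fin k → Bool) → any p ≡ false → ∀ i → p i ≡ false
any-false {suc k} p any≡false i       with p zero in p₀≡false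
any-false {suc k} p ()        i       | true
any-false {suc k} p any≡false zero    | false = p₀≡false
any-false {suc k} p any≡false (suc i) | false = any-false (p ∘ suc) any≡false i

count-none : ∀ {k} (p : Fin k → Bool) → (∀ i → p i ≡ false) → count p ≡ 0
count-none {k} p none = trans (sum-cong-≗ (cong ⟦_⟧ ∘ none)) (trans (∑-const k 0) (*-zeroʳ k))

1≤count : ∀ {k} (p : Fin k → Bool) {i} → p i ≡ true → 1 ≤ count p
1≤count p {zero}  pᵢ≡true rewrite pᵢ≡true = s≤s z≤n
1≤count p {suc i} pᵢ≡true = ≤-trans (1≤count (p ∘ suc) pᵢ≡true) (m≤n+m _ ⟦ p zero ⟧)

AtMostOne : ∀ {k} → (Fin k → Bool) → Set
AtMostOne p = ∀ {i j} → p i ≡ true → p j ≡ true → i ≡ j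

atMostOne⇒count≤1 : ∀ {k} (p : Fin k → Bool) → AtMostOne p → count p ≤ 1
atMostOne⇒count≤1 {zero}  p unique = z≤n
atMostOne⇒count≤1 {suc k} p unique with p zero in p₀≡true
... | true  = ≤-reflexive (cong suc (count-none (p ∘ suc) others))
  where
  others : ∀ i → p (suc i) ≡ false
  others i with p (suc i) in pᵢ≡true
  ... | false = refl
  ... | true  with () ← unique p₀≡true pᵢ≡true
... | false = atMostOne⇒count≤1 (p ∘ suc) (λ pᵢ pⱼ → suc-injective (unique pᵢ pⱼ))

count≤1⇒atMostOne : ∀ {k} (p : Fin k → Bool) → count p ≤ 1 → AtMostOne p
count≤1⇒atMostOne p count≤1 {zero}  {zero}  _ _ = refl
count≤1⇒atMostOne p count≤1 {zero}  {suc j} p₀≡true pⱼ≡true rewrite p₀≡true =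
  contradiction (s≤s⁻¹ count≤1) (<⇒≱ (1≤count (p ∘ suc) pⱼ≡true))
count≤1⇒atMostOne p count≤1 {suc i} {zero}  pᵢ≡true p₀≡true rewrite p₀≡true =
  contradiction (s≤s⁻¹ count≤1) (<⇒≱ (1≤count (p ∘ suc) pᵢ≡true))
count≤1⇒atMostOne p count≤1 {suc i} {suc j} pᵢ≡true pⱼ≡true =
  cong suc (count≤1⇒atMostOne (p ∘ suc) (≤-trans (m≤n+m _ ⟦ p zero ⟧) count≤1) pᵢ≡true pⱼ≡true)

count≤⟦any⟧ : ∀ {k} (p : Fin k → Bool) → AtMostOne p → count p ≤ ⟦ any p ⟧
count≤⟦any⟧ p unique with any p in any≡b
... | true  = atMostOne⇒count≤1 p unique
... | false = ≤-reflexive (count-none p (any-false p any≡b))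

count-except : ∀ {k} (p : Fin k → Bool) v → p v ≡ true →
               count (λ x → p x ∧ not (does (x ≟ v))) ≡ count p ∸ 1
count-except {suc k} p v pᵥ≡true = begin
  count q                                 ≡⟨ sum-remove {i = v} (⟦_⟧ ∘ q) ⟩
  ⟦ q v ⟧ + count (q ∘ punchIn v)
    ≡⟨ cong₂ _+_ (cong ⟦_⟧ qᵥ≡false) (sum-cong-≗ (cong ⟦_⟧ ∘ q∘punchIn)) ⟩
  count (p ∘ punchIn v)
    ≡⟨ cong (λ b → (⟦ b ⟧ + count (p ∘ punchIn v)) ∸ 1) pᵥ≡true ⟨
  (⟦ p v ⟧ + count (p ∘ punchIn v)) ∸ 1   ≡⟨ cong (_∸ 1) (sum-remove {i = v} (⟦_⟧ ∘ p)) ⟨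
  count p ∸ 1                             ∎
  where
  open ≡-Reasoning
  q : Fin (suc k) → Bool
  q x = p x ∧ not (does (x ≟ v))
  qᵥ≡false : q v ≡ false
  qᵥ≡false rewrite dec-true (v ≟ v) refl = ∧-zeroʳ (p v)
  q∘punchIn : ∀ x → q (punchIn v x) ≡ p (punchIn v x)
  q∘punchIn x rewrite dec-false (punchIn v x ≟ v) (punchInᵢ≢i v x) = ∧-identityʳ _

∷-injective : ∀ {A : Set} {k} {x : A} {xs : Vector A k} →
              Injective _≡_ _≡_ xs → (∀ i → xs i ≢ x) → Injective _≡_ _≡_ (x ∷ xs)
∷-injective xs-inj x∉xs {zero}  {zero}  _  = refl
∷-injective xs-inj x∉xs {zero}  {suc j} eq = ⊥-elim (x∉xs j (sym eq))
∷-injective xs-inj x∉xs {suc i} {zero}  eq = ⊥-elim (x∉xs i eq)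
∷-injective xs-inj x∉xs {suc i} {suc j} eq = cong suc (xs-inj eq)

injective₃ : ∀ {A : Set} {x y z : A} → x ≢ y → x ≢ z → y ≢ z →
             Injective _≡_ _≡_ (x ∷ y ∷ z ∷ [])
injective₃ x≢y x≢z y≢z =
  ∷-injective (∷-injective (∷-injective (λ { {()} }) (λ ())) λ { zero → y≢z ∘ sym ; (suc ()) })
              λ { zero → x≢y ∘ sym ; (suc zero) → x≢z ∘ sym ; (suc (suc ())) }

choose : ∀ {k} t (p : Fin k → Bool) → t ≤ count p →
         Σ[ b ∈ (Fin t → Fin k) ] Injective _≡_ _≡_ b × (∀ j → p (b j) ≡ true)
choose zero p _ = (λ ()) , (λ { {()} }) , (λ ())
choose {suc k} (suc t) p t<count with p zero in p₀≡true
... | false = let b , b-inj , p∘b = choose (suc t) (p ∘ suc) t<count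
              in suc ∘ b , (λ eq → b-inj (suc-injective eq)) , p∘b
... | true  = let b , b-inj , p∘b = choose t (p ∘ suc) (s≤s⁻¹ t<count)
              in zero ∷ (suc ∘ b) ,
                 ∷-injective (λ eq → b-inj (suc-injective eq)) (λ _ ()) ,
                 λ { zero → p₀≡true ; (suc j) → p∘b j }

BipartiteGraph : ℕ → ℕ → Set
BipartiteGraph m n = Fin m → Fin n → Bool

deg : ∀ {m n} → BipartiteGraph m n → Fin n → ℕ
deg A w = count (λ v → A v w)

KFree : ∀ {m n} → ℕ → ℕ → BipartiteGraph m n → Set
KFree {m} {n} s t A = ∀ (a : Fin s → Fin m) (b : Fin t → Fin n) →
  Injective _≡_ _≡_ a → Injective _≡_ _≡_ b → ¬ (∀ i j → A (a i) (b j) ≡ true)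

link : ∀ {m n} → BipartiteGraph m n → Fin m → BipartiteGraph m n
link A v x w = A v w ∧ A x w ∧ not (does (x ≟ v))

link-edge : ∀ {m n} (A : BipartiteGraph m n) {v x w} → link A v x w ≡ true →
            A v w ≡ true × A x w ≡ true × x ≢ v
link-edge A {v} {x} {w} linked with ∧-≡true linked
... | Avw , rest with ∧-≡true {A x w} rest
...   | Axw , x≢ᵇv = Avw , Axw , λ x≡v →
  contradiction (trans (sym x≢ᵇv) (cong not (dec-true (x ≟ v) x≡v))) λ ()

link-KFree : ∀ {m n} s t (A : BipartiteGraph m n) v →
             KFree (2 + s) (suc t) A → KFree (suc s) (suc t) (link A v)
link-KFree s t A v kfree a b a-inj b-inj complete =
  kfree (v ∷ a) b (∷-injective a-inj (λ i → proj₂ (proj₂ (link-edge A (complete i zero))))) b-inj λ where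
    zero    j → proj₁ (link-edge A (complete zero j))
    (suc i) j → proj₁ (proj₂ (link-edge A (complete i j)))

deg-link-↓ : ∀ {m n} (A : BipartiteGraph m n) v w k →
             deg (link A v) w ↓ suc k ≡ ⟦ A v w ⟧ * (deg A w ∸ 1) ↓ suc k
deg-link-↓ {m} A v w k with A v w in Avw≡b
... | true  = trans (cong (_↓ suc k) (count-except (λ x → A x w) v Avw≡b)) (sym (*-identityˡ _))
... | false = cong (_↓ suc k) (count-none {m} (λ _ → false) (λ _ → refl))

star-free⇒count≤ : ∀ {m n} t (A : BipartiteGraph m n) → KFree 1 (suc t) A → ∀ v → count (A v) ≤ t
star-free⇒count≤ t A kfree v = ≮⇒≥ λ t<count →
  let b , b-inj , A∘b = choose (suc t) (A v) t<count
  in kfree (λ _ → v) b (λ { {zero} {zero} _ → refl }) b-inj (λ _ → A∘b)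

kővári-sós-turán : ∀ {m n} s t (A : BipartiteGraph m n) → KFree (suc s) (suc t) A →
                   ∑[ w < n ] (deg A w ↓ suc s) ≤ t * m ^ suc s
kővári-sós-turán {m} {n} zero t A kfree = begin
  ∑[ w < n ] (deg A w * 1)            ≡⟨ sum-cong-≗ (λ w → *-identityʳ (deg A w)) ⟩
  ∑[ w < n ] ∑[ v < m ] ⟦ A v w ⟧     ≡⟨ ∑-comm (λ w v → ⟦ A v w ⟧) ⟩
  ∑[ v < m ] count (A v)              ≤⟨ ∑-mono-≤ (star-free⇒count≤ t A kfree) ⟩
  ∑[ v < m ] t                        ≡⟨ ∑-const m t ⟩
  m * t                               ≡⟨ *-comm m t ⟩
  t * m                               ≡⟨ cong (t *_) (*-identityʳ m) ⟨
  t * (m * 1)                         ∎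
  where open ≤-Reasoning
kővári-sós-turán {m} {n} (suc s) t A kfree = begin
  ∑[ w < n ] (deg A w * (deg A w ∸ 1) ↓ suc s)
      ≡⟨ sum-cong-≗ (λ w → *-distribʳ-sum ((deg A w ∸ 1) ↓ suc s) (λ v → ⟦ A v w ⟧)) ⟩
  ∑[ w < n ] ∑[ v < m ] (⟦ A v w ⟧ * (deg A w ∸ 1) ↓ suc s)
      ≡⟨ sum-cong-≗ (λ w → sum-cong-≗ (λ v → deg-link-↓ A v w s)) ⟨
  ∑[ w < n ] ∑[ v < m ] (deg (link A v) w ↓ suc s)
      ≡⟨ ∑-comm (λ w v → deg (link A v) w ↓ suc s) ⟩
  ∑[ v < m ] ∑[ w < n ] (deg (link A v) w ↓ suc s)
      ≤⟨ ∑-mono-≤ (λ v → kővári-sós-turán s t (link A v) (link-KFree s t A v kfree)) ⟩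
  ∑[ v < m ] (t * m ^ suc s)
      ≡⟨ ∑-const m (t * m ^ suc s) ⟩
  m * (t * m ^ suc s)
      ≡⟨ x*[y*z]≡y*[x*z] m t _ ⟩
  t * m ^ suc (suc s)                  ∎
  where
  open ≤-Reasoning
  x*[y*z]≡y*[x*z] : ∀ x y z → x * (y * z) ≡ y * (x * z)
  x*[y*z]≡y*[x*z] = solve-∀

∣S∣≡count : ∀ {k} (S : Subset k) → ∣ S ∣ ≡ count (lookup S)
∣S∣≡count Vec.[]           = refl
∣S∣≡count (true  Vec.∷ S) = cong suc (∣S∣≡count S)
∣S∣≡count (false Vec.∷ S) = ∣S∣≡count S

∣S∣≡count-↑ : ∀ {m n} (S : Subset (m + n)) →
              ∣ S ∣ ≡ count (λ v → lookup S (v ↑ˡ n)) + count (λ w → lookup S (m ↑ʳ w))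
∣S∣≡count-↑ {m} {n} S = trans (∣S∣≡count S) (∑-split m n (⟦_⟧ ∘ lookup S))

headPart-↑ˡ : ∀ {m} n (v : Fin m) → lookup (headPart {m} {n}) (v ↑ˡ n) ≡ true
headPart-↑ˡ n zero    = refl
headPart-↑ˡ n (suc v) = headPart-↑ˡ n v

toℕ-↑ʳ-≮ᵇ : ∀ m {n} (w : Fin n) → (toℕ (m ↑ʳ w) <ᵇ m) ≡ false
toℕ-↑ʳ-≮ᵇ zero    w = refl
toℕ-↑ʳ-≮ᵇ (suc m) w = toℕ-↑ʳ-≮ᵇ m w

headPart-↑ʳ : ∀ m {n} (w : Fin n) → lookup (headPart {m} {n}) (m ↑ʳ w) ≡ false
headPart-↑ʳ m w = trans (lookup∘tabulate _ (m ↑ʳ w)) (toℕ-↑ʳ-≮ᵇ m w)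

↑ˡ≢↑ʳ : ∀ {m n} (v : Fin m) (w : Fin n) → v ↑ˡ n ≢ m ↑ʳ w
↑ˡ≢↑ʳ {m} {n} v w eq
  with () ← trans (sym (splitAt-↑ˡ m v n)) (trans (cong (splitAt m) eq) (splitAt-↑ʳ m n w))

module Shadow {m n : ℕ} (H : Hypergraph m n) where

  infix 7 _∋ₕ_ _∋ₘ_

  _∋ₕ_ : Edge H → Fin m → Bool
  G ∋ₕ v = lookup (edge H G) (v ↑ˡ n)

  _∋ₘ_ : Edge H → Fin n → Bool
  G ∋ₘ w = lookup (edge H G) (m ↑ʳ w)

  shadow : BipartiteGraph m n
  shadow v w = any (λ G → G ∋ₕ v ∧ G ∋ₘ w)

  count-heads : IsHmBipartite H → ∀ G → count (G ∋ₕ_) ≡ 1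
  count-heads bip G = begin
    count (G ∋ₕ_)
      ≡⟨ +-identityʳ _ ⟨
    count (G ∋ₕ_) + 0
      ≡⟨ cong₂ _+_ (sum-cong-≗ (cong ⟦_⟧ ∘ S∋ₕ)) (count-none _ S∌ₘ) ⟨
    count (λ v → lookup S (v ↑ˡ n)) + count (λ w → lookup S (m ↑ʳ w))
      ≡⟨ ∣S∣≡count-↑ {m} {n} S ⟨
    ∣ S ∣
      ≡⟨ bip G ⟩
    1 ∎
    where
    open ≡-Reasoning
    S = edge H G ∩ headPart {m} {n}
    S∋ₕ : ∀ v → lookup S (v ↑ˡ n) ≡ G ∋ₕ v
    S∋ₕ v = trans (lookup-zipWith _∧_ (v ↑ˡ n) (edge H G) (headPart {m} {n}))
                  (trans (cong (G ∋ₕ v ∧_) (headPart-↑ˡ n v)) (∧-identityʳ _))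
    S∌ₘ : ∀ w → lookup S (m ↑ʳ w) ≡ false
    S∌ₘ w = trans (lookup-zipWith _∧_ (m ↑ʳ w) (edge H G) (headPart {m} {n}))
                  (trans (cong (G ∋ₘ w ∧_) (headPart-↑ʳ m w)) (∧-zeroʳ _))

  count-masses : ∀ {r} → IsUniform r H → IsHmBipartite H → ∀ G → count (G ∋ₘ_) ≡ r ∸ 1
  count-masses {r} (_ , size) bip G = cong (_∸ 1) (begin
    1 + count (G ∋ₘ_)              ≡⟨ cong (_+ count (G ∋ₘ_)) (count-heads bip G) ⟨
    count (G ∋ₕ_) + count (G ∋ₘ_)  ≡⟨ ∣S∣≡count-↑ {m} {n} (edge H G) ⟨
    ∣ edge H G ∣                    ≡⟨ size G ⟩
    r                              ∎)
    where open ≡-Reasoning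

  head-unique : IsHmBipartite H → ∀ G → AtMostOne (G ∋ₕ_)
  head-unique bip G = count≤1⇒atMostOne (G ∋ₕ_) (≤-reflexive (count-heads bip G))

  shared-vertex-unique : IsLinear H → ∀ {G G'} → G ≢ G' → ∀ {u u'} →
    lookup (edge H G) u ≡ true → lookup (edge H G') u ≡ true →
    lookup (edge H G) u' ≡ true → lookup (edge H G') u' ≡ true → u ≡ u'
  shared-vertex-unique lin {G} {G'} G≢G' Gu G'u Gu' G'u' =
    count≤1⇒atMostOne (lookup (edge H G ∩ edge H G'))
      (subst (_≤ 1) (∣S∣≡count (edge H G ∩ edge H G')) (lin G G' G≢G')) (shared Gu G'u) (shared Gu' G'u')
    where
    shared : ∀ {u} → lookup (edge H G) u ≡ true → lookup (edge H G') u ≡ true →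
             lookup (edge H G ∩ edge H G') u ≡ true
    shared {u} Gu G'u = trans (lookup-zipWith _∧_ u (edge H G) (edge H G')) (cong₂ _∧_ Gu G'u)

  edge-unique : IsLinear H → ∀ v w → AtMostOne (λ G → G ∋ₕ v ∧ G ∋ₘ w)
  edge-unique lin v w {G} {G'} Gvw G'vw = decidable-stable (G ≟ G') λ G≢G' →
    let Gv , Gw = ∧-≡true {G ∋ₕ v} Gvw
        G'v , G'w = ∧-≡true {G' ∋ₕ v} G'vw
    in ↑ˡ≢↑ʳ v w (shared-vertex-unique lin G≢G' Gv G'v Gw G'w)

  count-∋ₘ≤deg : IsHmBipartite H → IsLinear H → ∀ w → count (_∋ₘ w) ≤ deg shadow w
  count-∋ₘ≤deg bip lin w = begin
    ∑[ G < e H ] ⟦ G ∋ₘ w ⟧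
      ≡⟨ sum-cong-≗ (λ G → *-identityˡ ⟦ G ∋ₘ w ⟧) ⟨
    ∑[ G < e H ] (1 * ⟦ G ∋ₘ w ⟧)
      ≡⟨ sum-cong-≗ (λ G → cong (_* ⟦ G ∋ₘ w ⟧) (count-heads bip G)) ⟨
    ∑[ G < e H ] (count (G ∋ₕ_) * ⟦ G ∋ₘ w ⟧)
      ≡⟨ sum-cong-≗ (λ G → *-distribʳ-sum ⟦ G ∋ₘ w ⟧ (λ v → ⟦ G ∋ₕ v ⟧)) ⟩
    ∑[ G < e H ] ∑[ v < m ] (⟦ G ∋ₕ v ⟧ * ⟦ G ∋ₘ w ⟧)
      ≡⟨ ∑-comm (λ G v → ⟦ G ∋ₕ v ⟧ * ⟦ G ∋ₘ w ⟧) ⟩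
    ∑[ v < m ] ∑[ G < e H ] (⟦ G ∋ₕ v ⟧ * ⟦ G ∋ₘ w ⟧)
      ≡⟨ sum-cong-≗ (λ v → sum-cong-≗ (λ G → ⟦∧⟧ (G ∋ₕ v) (G ∋ₘ w))) ⟨
    ∑[ v < m ] count (λ G → G ∋ₕ v ∧ G ∋ₘ w)
      ≤⟨ ∑-mono-≤ (λ v → count≤⟦any⟧ (λ G → G ∋ₕ v ∧ G ∋ₘ w) (edge-unique lin v w)) ⟩
    deg shadow w ∎
    where open ≤-Reasoning

  [r∸1]*e≤∑deg : ∀ {r} → IsUniform r H → IsHmBipartite H → IsLinear H →
                 (r ∸ 1) * e H ≤ ∑[ w < n ] deg shadow w
  [r∸1]*e≤∑deg {r} uniform bip lin = begin
    (r ∸ 1) * e H                 ≡⟨ *-comm (r ∸ 1) (e H) ⟩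
    e H * (r ∸ 1)                 ≡⟨ ∑-const (e H) (r ∸ 1) ⟨
    ∑[ G < e H ] (r ∸ 1)          ≡⟨ sum-cong-≗ (count-masses uniform bip) ⟨
    ∑[ G < e H ] count (G ∋ₘ_)    ≡⟨ ∑-comm (λ G w → ⟦ G ∋ₘ w ⟧) ⟩
    ∑[ w < n ] count (_∋ₘ w)      ≤⟨ ∑-mono-≤ (count-∋ₘ≤deg bip lin) ⟩
    ∑[ w < n ] deg shadow w       ∎
    where open ≤-Reasoning

  ∋ₕ⇒∈ : ∀ {G v} → G ∋ₕ v ≡ true → v ↑ˡ n ∈ edge H G
  ∋ₕ⇒∈ {G} {v} = lookup⇒[]= (v ↑ˡ n) (edge H G)

  ∋ₘ⇒∈ : ∀ {G w} → G ∋ₘ w ≡ true → m ↑ʳ w ∈ edge H G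
  ∋ₘ⇒∈ {G} {w} = lookup⇒[]= (m ↑ʳ w) (edge H G)

  berge-triangle : IsLinear H → ∀ {v w w' G₀ G₁ G₂} → w ≢ w' →
    ¬ (G₀ ∋ₕ v ≡ true) → G₀ ∋ₘ w ≡ true → G₀ ∋ₘ w' ≡ true →
    G₁ ∋ₕ v ≡ true → G₁ ∋ₘ w ≡ true → G₂ ∋ₕ v ≡ true → G₂ ∋ₘ w' ≡ true →
    ContainsBergeC3 H
  berge-triangle lin {v} {w} {w'} {G₀} {G₁} {G₂} w≢w' G₀∌v G₀w G₀w' G₁v G₁w G₂v G₂w' =
    (v ↑ˡ n) ∷ (m ↑ʳ w) ∷ (m ↑ʳ w') ∷ [] ,
    G₁ ∷ G₀ ∷ G₂ ∷ [] ,
    injective₃ (↑ˡ≢↑ʳ v w) (↑ˡ≢↑ʳ v w') (w≢w' ∘ ↑ʳ-injective m w w') ,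
    injective₃ G₁≢G₀ G₁≢G₂ G₀≢G₂ ,
    λ { zero             → ∋ₕ⇒∈ G₁v , ∋ₘ⇒∈ G₁w
      ; (suc zero)       → ∋ₘ⇒∈ G₀w , ∋ₘ⇒∈ G₀w'
      ; (suc (suc zero)) → ∋ₘ⇒∈ G₂w' , ∋ₕ⇒∈ G₂v }
    where
    G₁≢G₀ : G₁ ≢ G₀
    G₁≢G₀ G₁≡G₀ = G₀∌v (subst (λ G → G ∋ₕ v ≡ true) G₁≡G₀ G₁v)
    G₀≢G₂ : G₀ ≢ G₂
    G₀≢G₂ G₀≡G₂ = G₀∌v (subst (λ G → G ∋ₕ v ≡ true) (sym G₀≡G₂) G₂v)
    G₁≢G₂ : G₁ ≢ G₂
    G₁≢G₂ G₁≡G₂ = w≢w' (↑ʳ-injective m w w'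
      (shared-vertex-unique lin G₁≢G₀ G₁w G₀w G₁w' G₀w'))
      where G₁w' = subst (λ G → G ∋ₘ w' ≡ true) (sym G₁≡G₂) G₂w'

  shadow-KFree : IsHmBipartite H → IsLinear H → BergeC3Free H →
                 ∀ {s t} → ExactBergeKFree (2 + s) t H → KFree (2 + s) t shadow
  shadow-KFree bip lin c3free {s} {t} kfree a b a-inj b-inj complete =
    kfree ((_↑ˡ n) ∘ a , (m ↑ʳ_) ∘ b , g ,
           (a-inj ∘ ↑ˡ-injective n _ _) , (b-inj ∘ ↑ʳ-injective m _ _) , g-inj ,
           (λ i → subst (_< m) (sym (toℕ-↑ˡ (a i) n)) (toℕ<n (a i))) ,
           (λ j → subst (m ≤_) (sym (toℕ-↑ʳ m (b j))) (m≤m+n m (toℕ (b j)))) ,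
           λ i j → ∋ₕ⇒∈ (g∋ₕ i j) , ∋ₘ⇒∈ (g∋ₘ i j))
    where
    witness : ∀ i j → ∃[ G ] G ∋ₕ a i ∧ G ∋ₘ b j ≡ true
    witness i j = any-witness (λ G → G ∋ₕ a i ∧ G ∋ₘ b j) (complete i j)
    g : Fin (2 + s) × Fin t → Edge H
    g (i , j) = proj₁ (witness i j)
    g∋ₕ : ∀ i j → g (i , j) ∋ₕ a i ≡ true
    g∋ₕ i j = proj₁ (∧-≡true (proj₂ (witness i j)))
    g∋ₘ : ∀ i j → g (i , j) ∋ₘ b j ≡ true
    g∋ₘ i j = proj₂ (∧-≡true {g (i , j) ∋ₕ a i} (proj₂ (witness i j)))
    same-row : ∀ {i i' j j'} → g (i , j) ≡ g (i' , j') → i ≡ i'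
    same-row {i} {i'} {j} {j'} gᵢⱼ≡gᵢ'ⱼ' =
      a-inj (head-unique bip (g (i , j)) (g∋ₕ i j)
                         (subst (λ G → G ∋ₕ a i' ≡ true) (sym gᵢⱼ≡gᵢ'ⱼ') (g∋ₕ i' j')))
    same-column : ∀ {i j j'} → g (i , j) ≡ g (i , j') → j ≡ j'
    same-column {i} {j} {j'} gᵢⱼ≡gᵢⱼ' = decidable-stable (j ≟ j') λ j≢j' →
      c3free (berge-triangle lin (j≢j' ∘ b-inj)
        (λ G₀∋aₖ → punchInᵢ≢i i zero (a-inj (head-unique bip (g (i , j)) G₀∋aₖ (g∋ₕ i j))))
        (g∋ₘ i j) (subst (λ G → G ∋ₘ b j' ≡ true) (sym gᵢⱼ≡gᵢⱼ') (g∋ₘ i j'))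
        (g∋ₕ k j) (g∋ₘ k j) (g∋ₕ k j') (g∋ₘ k j'))
      where k = punchIn i zero
    g-inj : Injective _≡_ _≡_ g
    g-inj {i , j} {i' , j'} gᵢⱼ≡gᵢ'ⱼ'
      with refl ← same-row gᵢⱼ≡gᵢ'ⱼ' = cong (i ,_) (same-column gᵢⱼ≡gᵢ'ⱼ')

lemma3p5 : (r s t m n : ℕ) → 2 ≤ r → 2 ≤ s → 2 ≤ t →
    (H : Hypergraph m n) →
    IsUniform r H → IsHmBipartite H → IsLinear H →
    ExactBergeKFree s t H → BergeC3Free H →
    ((r ∸ 1) * e H ∸ (s ∸ 1) * n) ^ s ≤ (t ∸ 1) * (m ^ s * n ^ (s ∸ 1))
lemma3p5 _ 0 _ _ _ _ ()
lemma3p5 _ 1 _ _ _ _ (s≤s ())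
lemma3p5 _ (suc (suc _)) 0 _ _ _ _ ()
-- The argument never uses r ≥ 2.
lemma3p5 r (suc (suc s)) (suc t) m n _ _ _ H uniform bip lin kfree c3free = begin
  ((r ∸ 1) * e H ∸ k * n) ^ suc k
    ≤⟨ ^-monoˡ-≤ (suc k) excess≤ ⟩
  (∑[ w < n ] (d w ∸ k)) ^ suc k
    ≤⟨ power-mean k (λ w → d w ∸ k) ⟩
  n ^ k * ∑[ w < n ] ((d w ∸ k) ^ suc k)
    ≤⟨ *-monoʳ-≤ (n ^ k) (∑-mono-≤ (λ w → [d∸k]^[1+k]≤d↓[1+k] (d w) k)) ⟩
  n ^ k * ∑[ w < n ] (d w ↓ suc k)
    ≤⟨ *-monoʳ-≤ (n ^ k) (kővári-sós-turán k t shadow (shadow-KFree bip lin c3free kfree)) ⟩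
  n ^ k * (t * m ^ suc k)
    ≡⟨ x*[y*z]≡y*[z*x] (n ^ k) t (m ^ suc k) ⟩
  t * (m ^ suc k * n ^ k) ∎
  where
  open ≤-Reasoning
  open Shadow H
  k = suc s
  d = deg shadow
  excess≤ : (r ∸ 1) * e H ∸ k * n ≤ ∑[ w < n ] (d w ∸ k)
  excess≤ = ≤-trans (∸-monoˡ-≤ (k * n) ([r∸1]*e≤∑deg uniform bip lin)) (∑-∸-const d k)
  x*[y*z]≡y*[z*x] : ∀ x y z → x * (y * z) ≡ y * (z * x)
  x*[y*z]≡y*[z*x] = solve-∀
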